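{- Let $A$ be an $n\times n$ irreducible stochastic matrix. If $A$ is periodic, then $\det(I-A^{[2]})=0$.
   Context: $A$ is periodic if its digraph (vertices $\{1,\ldots,n\}$, edge $i\to j$ iff $A_{ij}>0$) admits a partition $\{P_1,\ldots,P_t\}$ with $t\ge2$ such that every edge from $P_k$ ends in $P_{k+1}$ (indices mod $t$). $A^{[2]}$ is the $\binom n2\times\binom n2$ matrix with rows and columns indexed by pairs $(i,j)$ with $1\le i<j\le n$, whose entry in row $(i,j)$ and column $(l,m)$ ($l<m$) is $A_{il}A_{jm}+A_{im}A_{jl}$ (the permanent of the $2\times2$ submatrix of $A$ with rows $i,j$ and columns $l,m$). $I$ is the identity matrix of that size. -}

module Defs where

open import Level using (Level; _⊔_)
open import Algebra.Bundles using (CommutativeRing)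
open import Data.Nat using (ℕ; zero; suc; _≤_)
open import Data.Fin using (Fin; zero; suc; toℕ; punchIn)
open import Data.Product using (Σ; _×_; _,_; ∃-syntax; proj₁; proj₂)
open import Data.Sum using (_⊎_)
open import Data.List using (List; []; _∷_; _++_; map; concatMap; length; lookup)
open import Relation.Binary.PropositionalEquality using (_≡_)
open import Relation.Binary.Construct.Closure.ReflexiveTransitive using (Star)
open import Relation.Nullary using (¬_)
open import Function.Definitions using (Surjective)

-- Ordered fields (the real numbers are one; stdlib has no ℝ).

record OrderedField (c ℓ : Level) : Set (Level.suc (c ⊔ ℓ)) where
  field
    commutativeRing : CommutativeRing c ℓ
  open CommutativeRing commutativeRing public
  field
    Pos        : Carrier → Set ℓ
    Pos-resp   : ∀ {x y} → x ≈ y → Pos x → Pos y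
    Pos-+      : ∀ {x y} → Pos x → Pos y → Pos (x + y)
    Pos-*      : ∀ {x y} → Pos x → Pos y → Pos (x * y)
    trichotomy : ∀ x → Pos x ⊎ (x ≈ 0# ⊎ Pos (- x))
    Pos-irrefl : ¬ Pos 0#
    Pos-asym   : ∀ {x} → Pos x → ¬ Pos (- x)
    nontrivial : ¬ (0# ≈ 1#)
    inverse    : ∀ x → ¬ (x ≈ 0#) → ∃[ y ] (x * y ≈ 1#)

module _ {c ℓ : Level} (F : OrderedField c ℓ) where
  open OrderedField F
    using (Carrier; _≈_; _+_; _*_; -_; _-_; 0#; 1#; Pos)

  Matrix : ℕ → Set c
  Matrix n = Fin n → Fin n → Carrier

  NonNeg : Carrier → Set ℓ
  NonNeg x = Pos x ⊎ x ≈ 0#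

  sumFin : ∀ n → (Fin n → Carrier) → Carrier
  sumFin zero    f = 0#
  sumFin (suc n) f = f zero + sumFin n (λ i → f (suc i))

  signed : ℕ → Carrier → Carrier
  signed zero          x = x
  signed (suc zero)    x = - x
  signed (suc (suc k)) x = signed k x

  det : ∀ n → Matrix n → Carrier
  det zero    M = 1#
  det (suc n) M = sumFin (suc n) λ j →
    signed (toℕ j) (M zero j * det n (λ r s → M (suc r) (punchIn j s)))

  identity : ∀ {m : ℕ} → Matrix m
  identity {suc m} zero    zero    = 1#
  identity {suc m} zero    (suc j) = 0#
  identity {suc m} (suc i) zero    = 0#
  identity {suc m} (suc i) (suc j) = identity i j

  _-ᴹ_ : ∀ {m} → Matrix m → Matrix m → Matrix m
  (M -ᴹ N) i j = M i j - N i j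

  Stochastic : ∀ {n} → Matrix n → Set ℓ
  Stochastic {n} A = (∀ i j → NonNeg (A i j)) × (∀ i → sumFin n (A i) ≈ 1#)

  Edge : ∀ {n} → Matrix n → Fin n → Fin n → Set ℓ
  Edge A i j = Pos (A i j)

  Irreducible : ∀ {n} → Matrix n → Set ℓ
  Irreducible A = ∀ i j → Star (Edge A) i j

  -- periodic: a partition {P_0,…,P_{t-1}}, t ≥ 2, given by a surjective
  -- class map cl (blocks nonempty), such that every edge from P_k ends in
  -- P_{k+1 mod t}
  Periodic : ∀ {n} → Matrix n → Set ℓ
  Periodic {n} A =
    ∃[ t ] (2 ≤ t × ∃[ cl ] (Surjective _≡_ _≡_ cl × (∀ i j → Edge A i j → NextClass t (cl i) (cl j))))
    where
    NextClass : ∀ t → Fin t → Fin t → Set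
    NextClass t k l = (suc (toℕ k) ≡ toℕ l) ⊎ (suc (toℕ k) ≡ t × toℕ l ≡ 0)

  -- the pairs (i , j) with i < j, in lexicographic order
  pairs : ∀ n → List (Fin n × Fin n)
  pairs zero    = []
  pairs (suc n) = map (λ j → (zero , suc j)) (allFin' n)
                  ++ map (λ p → (suc (proj₁ p) , suc (proj₂ p))) (pairs n)
    where
    allFin' : ∀ m → List (Fin m)
    allFin' zero    = []
    allFin' (suc m) = zero ∷ map suc (allFin' m)

  C2 : ℕ → ℕ
  C2 n = length (pairs n)

  pair : ∀ {n} → Fin (C2 n) → Fin n × Fin n
  pair {n} = lookup (pairs n)

  compound2 : ∀ {n} → Matrix n → Matrix (C2 n)
  compound2 A p q with pair p | pair q
  ... | (i , j) | (l , m) = A i l * A j m + A i m * A j l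

module Submission where

-- Let cl be the class map of a periodic structure of A, and put
-- g (l , m) = 0 if cl l = cl m and 1 otherwise.  Edges move a whole class
-- to a single class and different classes to different classes, so for a
-- pair (i , j) the product A i l * A j m can only be nonzero when
-- [cl l ≠ cl m] = [cl i ≠ cl j].  Hence, A being stochastic,
--   (A^[2] g) (i , j) = g (i , j) * Σ_{l<m} (A i l A j m + A i m A j l)
--                     = g (i , j) * Σ_l Σ_m A i l A j m = g (i , j),
-- where the diagonal terms A i l A j l vanish when i, j lie in different
-- classes.  As t ≥ 2 and cl is onto, g ≠ 0 is a kernel vector of
-- I - A^[2], and a square matrix with a nonzero kernel vector has
-- determinant zero.

open import Level using (Level)
open import Defs

open import Data.Nat using (ℕ; zero; suc; _≤_; _<_; s≤s)
import Data.Nat.Properties as ℕ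
open import Data.Fin using (Fin; zero; suc; toℕ; inject₁; punchIn; _≟_)
open import Data.Fin.Properties using (toℕ-inject₁; toℕ-injective; toℕ<n; <-cmp)
open import Data.Product using (∃-syntax; _×_; _,_; proj₁; proj₂)
open import Data.Sum using (_⊎_; inj₁; inj₂)
open import Data.List using (List; []; _∷_; _++_; map; length; lookup)
open import Data.List.Membership.Propositional using (_∈_)
open import Data.List.Membership.Propositional.Properties using (∈-++⁺ˡ; ∈-++⁺ʳ; ∈-map⁺)
open import Data.List.Relation.Unary.Any using (here; there; index)
open import Data.List.Relation.Unary.Any.Properties using (lookup-index)
open import Data.Empty using (⊥-elim)
open import Data.Maybe using (nothing)
open import Function.Definitions using (Surjective)
open import Relation.Nullary using (¬_; Dec; yes; no)
open import Relation.Binary using (tri<; tri≈; tri>)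
open import Relation.Binary.PropositionalEquality as ≡ using (_≡_; _≢_)
open import Tactic.RingSolver.Core.AlmostCommutativeRing using (fromCommutativeRing)
open import Tactic.RingSolver.Core.Expression using (_⊕_; _⊗_)

module _ {c ℓ : Level} (F : OrderedField c ℓ) where

  open OrderedField F hiding (zero)
  open import Algebra.Properties.Ring ring
    using (-‿involutive; -‿injective; -0#≈0#; -‿+-comm; -‿distribˡ-*; -‿distribʳ-*; +-inverseʳ-unique)
  open import Relation.Binary.Reasoning.Setoid setoid
  open import Tactic.RingSolver.NonReflective (fromCommutativeRing commutativeRing (λ _ → nothing))
    using (solve; _⊜_)

  Σ[_]_ : ∀ n → (Fin n → Carrier) → Carrier
  Σ[_]_ = sumFin F

  +-interchange : ∀ a b u d → (a + b) + (u + d) ≈ (a + u) + (b + d)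
  +-interchange = solve 4 (λ a b u d → ((a ⊕ b) ⊕ (u ⊕ d)) ⊜ ((a ⊕ u) ⊕ (b ⊕ d))) refl

  +-leftComm : ∀ a b u → a + (b + u) ≈ b + (a + u)
  +-leftComm = solve 3 (λ a b u → (a ⊕ (b ⊕ u)) ⊜ (b ⊕ (a ⊕ u))) refl

  *-distrib-combination : ∀ x a y b z → x * (a * y + b * z) ≈ a * (x * y) + b * (x * z)
  *-distrib-combination =
    solve 5 (λ x a y b z → (x ⊗ (a ⊗ y ⊕ b ⊗ z)) ⊜ (a ⊗ (x ⊗ y) ⊕ b ⊗ (x ⊗ z))) refl

  collect : ∀ a b x y D S S' → (a * x + b * y) * D + (a * S + b * S') ≈ a * (x * D + S) + b * (y * D + S')
  collect a b x y D S S' = begin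
    (a * x + b * y) * D + (a * S + b * S')          ≈⟨ +-congʳ (distribʳ D (a * x) (b * y)) ⟩
    ((a * x) * D + (b * y) * D) + (a * S + b * S')  ≈⟨ +-interchange _ _ _ _ ⟩
    ((a * x) * D + a * S) + ((b * y) * D + b * S')  ≈⟨ +-cong (factor a x) (factor b y) ⟩
    a * (x * D + S) + b * (y * D + S')              ∎
    where
    factor : ∀ e z {T} → (e * z) * D + e * T ≈ e * (z * D + T)
    factor e z = trans (+-congʳ (*-assoc e z D)) (sym (distribˡ e _ _))

  1-pos : Pos 1#
  1-pos with trichotomy 1#
  ... | inj₁ p        = p
  ... | inj₂ (inj₁ e) = ⊥-elim (nontrivial (sym e))
  ... | inj₂ (inj₂ p) = Pos-resp (trans (sym (-‿distribˡ-* 1# (- 1#)))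
                                  (trans (-‿cong (*-identityˡ (- 1#))) (-‿involutive 1#)))
                                 (Pos-* p p)

  cancel-nonzero : ∀ {a x} → ¬ a ≈ 0# → a * x ≈ 0# → x ≈ 0#
  cancel-nonzero {a} {x} a≉0 ax≈0 with inverse a a≉0
  ... | b , ab≈1 = begin
    x             ≈⟨ *-identityˡ x ⟨
    1# * x        ≈⟨ *-congʳ (trans (sym ab≈1) (*-comm a b)) ⟩
    (b * a) * x   ≈⟨ *-assoc b a x ⟩
    b * (a * x)   ≈⟨ *-congˡ ax≈0 ⟩
    b * 0#        ≈⟨ zeroʳ b ⟩
    0#            ∎

  self-negative⇒0 : ∀ {x} → x ≈ - x → x ≈ 0#
  self-negative⇒0 {x} x≈-x = cancel-nonzero 2≉0 (begin
    (1# + 1#) * x  ≈⟨ distribʳ x 1# 1# ⟩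
    1# * x + 1# * x ≈⟨ +-cong (*-identityˡ x) (*-identityˡ x) ⟩
    x + x          ≈⟨ +-congˡ x≈-x ⟩
    x + - x        ≈⟨ -‿inverseʳ x ⟩
    0#             ∎)
    where
    2≉0 : ¬ (1# + 1#) ≈ 0#
    2≉0 e = Pos-irrefl (Pos-resp e (Pos-+ 1-pos 1-pos))

  negation≈0 : ∀ {x} → - x ≈ 0# → x ≈ 0#
  negation≈0 e = -‿injective (trans e (sym -0#≈0#))

  sum-cong : ∀ n {f g : Fin n → Carrier} → (∀ i → f i ≈ g i) → Σ[ n ] f ≈ Σ[ n ] g
  sum-cong zero    e = refl
  sum-cong (suc n) e = +-cong (e zero) (sum-cong n (λ i → e (suc i)))

  sum-zero : ∀ n {f : Fin n → Carrier} → (∀ i → f i ≈ 0#) → Σ[ n ] f ≈ 0#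
  sum-zero zero    e = refl
  sum-zero (suc n) e = trans (+-cong (e zero) (sum-zero n (λ i → e (suc i)))) (+-identityʳ 0#)

  sum-+ : ∀ n (f g : Fin n → Carrier) → Σ[ n ] (λ i → f i + g i) ≈ Σ[ n ] f + Σ[ n ] g
  sum-+ zero    f g = sym (+-identityʳ 0#)
  sum-+ (suc n) f g = trans (+-congˡ (sum-+ n _ _)) (+-interchange (f zero) (g zero) _ _)

  sum-*ˡ : ∀ n a (f : Fin n → Carrier) → Σ[ n ] (λ i → a * f i) ≈ a * Σ[ n ] f
  sum-*ˡ zero    a f = sym (zeroʳ a)
  sum-*ˡ (suc n) a f = trans (+-congˡ (sum-*ˡ n a _)) (sym (distribˡ a (f zero) _))

  sum-neg : ∀ n (f : Fin n → Carrier) → Σ[ n ] (λ i → - f i) ≈ - Σ[ n ] f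
  sum-neg zero    f = sym -0#≈0#
  sum-neg (suc n) f = trans (+-congˡ (sum-neg n _)) (-‿+-comm (f zero) _)

  sum-combination : ∀ n a b (f g : Fin n → Carrier) →
    Σ[ n ] (λ i → a * f i + b * g i) ≈ a * Σ[ n ] f + b * Σ[ n ] g
  sum-combination n a b f g = trans (sum-+ n _ _) (+-cong (sum-*ˡ n a f) (sum-*ˡ n b g))

  sum-identity : ∀ n (p : Fin n) (v : Fin n → Carrier) → Σ[ n ] (λ q → identity F p q * v q) ≈ v p
  sum-identity (suc n) zero    v =
    trans (+-cong (*-identityˡ _) (sum-zero n (λ q → zeroˡ _))) (+-identityʳ _)
  sum-identity (suc n) (suc p) v =
    trans (+-cong (zeroˡ _) (sum-identity n p (λ q → v (suc q)))) (+-identityˡ _)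

  swap : ∀ {n} → Fin n → Fin (suc n) → Fin (suc n)
  swap zero    zero          = suc zero
  swap zero    (suc zero)    = zero
  swap zero    (suc (suc j)) = suc (suc j)
  swap (suc k) zero          = zero
  swap (suc k) (suc j)       = suc (swap k j)

  sum-swap : ∀ n (k : Fin n) (f : Fin (suc n) → Carrier) → Σ[ suc n ] (λ j → f (swap k j)) ≈ Σ[ suc n ] f
  sum-swap (suc n) zero    f = +-leftComm _ _ _
  sum-swap (suc n) (suc k) f = +-congˡ (sum-swap n k (λ j → f (suc j)))

  swap-left : ∀ {n} (k : Fin n) → swap k (inject₁ k) ≡ suc k
  swap-left zero    = ≡.refl
  swap-left (suc k) = ≡.cong suc (swap-left k)

  swap-right : ∀ {n} (k : Fin n) → swap k (suc k) ≡ inject₁ k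
  swap-right zero    = ≡.refl
  swap-right (suc k) = ≡.cong suc (swap-right k)

  swap-other : ∀ {n} (k : Fin n) j → j ≢ inject₁ k → j ≢ suc k → swap k j ≡ j
  swap-other zero    zero          ≢l ≢r = ⊥-elim (≢l ≡.refl)
  swap-other zero    (suc zero)    ≢l ≢r = ⊥-elim (≢r ≡.refl)
  swap-other zero    (suc (suc j)) ≢l ≢r = ≡.refl
  swap-other (suc k) zero          ≢l ≢r = ≡.refl
  swap-other (suc k) (suc j)       ≢l ≢r =
    ≡.cong suc (swap-other k j (λ e → ≢l (≡.cong suc e)) (λ e → ≢r (≡.cong suc e)))

  -- How the swap acts on the columns of a Laplace minor: deleting column k
  -- or k + 1 of the swapped matrix gives the other minor unchanged, deleting
  -- any other column gives that minor with two adjacent columns swapped.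

  swap-punchIn-left : ∀ {n} (k : Fin n) s → swap k (punchIn (inject₁ k) s) ≡ punchIn (suc k) s
  swap-punchIn-left zero    zero    = ≡.refl
  swap-punchIn-left zero    (suc s) = ≡.refl
  swap-punchIn-left (suc k) zero    = ≡.refl
  swap-punchIn-left (suc k) (suc s) = ≡.cong suc (swap-punchIn-left k s)

  swap-punchIn-right : ∀ {n} (k : Fin n) s → swap k (punchIn (suc k) s) ≡ punchIn (inject₁ k) s
  swap-punchIn-right zero    zero    = ≡.refl
  swap-punchIn-right zero    (suc s) = ≡.refl
  swap-punchIn-right (suc k) zero    = ≡.refl
  swap-punchIn-right (suc k) (suc s) = ≡.cong suc (swap-punchIn-right k s)

  swap-punchIn-other : ∀ {n} (k : Fin (suc n)) (j : Fin (suc (suc n))) → j ≢ inject₁ k → j ≢ suc k →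
    ∃[ k' ] (∀ s → swap k (punchIn j s) ≡ punchIn j (swap k' s))
  swap-punchIn-other zero zero ≢l ≢r = ⊥-elim (≢l ≡.refl)
  swap-punchIn-other zero (suc zero) ≢l ≢r = ⊥-elim (≢r ≡.refl)
  swap-punchIn-other {zero} zero (suc (suc ())) ≢l ≢r
  swap-punchIn-other {suc n} zero (suc (suc j)) ≢l ≢r = zero , commute
    where
    commute : ∀ s → swap zero (punchIn (suc (suc j)) s) ≡ punchIn (suc (suc j)) (swap zero s)
    commute zero          = ≡.refl
    commute (suc zero)    = ≡.refl
    commute (suc (suc s)) = ≡.refl
  swap-punchIn-other (suc k) zero ≢l ≢r = k , λ s → ≡.refl
  swap-punchIn-other {zero} (suc ()) (suc j) ≢l ≢r
  swap-punchIn-other {suc n} (suc k) (suc j) ≢l ≢r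
    with swap-punchIn-other k j (λ e → ≢l (≡.cong suc e)) (λ e → ≢r (≡.cong suc e))
  ... | k' , commute = suc k' , commute'
    where
    commute' : ∀ s → swap (suc k) (punchIn (suc j) s) ≡ punchIn (suc j) (swap (suc k') s)
    commute' zero    = ≡.refl
    commute' (suc s) = ≡.cong suc (commute s)

  signed-cong : ∀ m {x y} → x ≈ y → signed F m x ≈ signed F m y
  signed-cong zero          e = e
  signed-cong (suc zero)    e = -‿cong e
  signed-cong (suc (suc m)) e = signed-cong m e

  signed-suc : ∀ m x → signed F (suc m) x ≈ - signed F m x
  signed-suc zero          x = refl
  signed-suc (suc zero)    x = sym (-‿involutive x)
  signed-suc (suc (suc m)) x = signed-suc m x

  signed-neg : ∀ m x → signed F m (- x) ≈ - signed F m x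
  signed-neg zero          x = refl
  signed-neg (suc zero)    x = refl
  signed-neg (suc (suc m)) x = signed-neg m x

  signed-combination : ∀ m x a y b z →
    signed F m (x * (a * y + b * z)) ≈ a * signed F m (x * y) + b * signed F m (x * z)
  signed-combination zero          x a y b z = *-distrib-combination x a y b z
  signed-combination (suc zero)    x a y b z = begin
    - (x * (a * y + b * z))         ≈⟨ -‿cong (*-distrib-combination x a y b z) ⟩
    - (a * (x * y) + b * (x * z))   ≈⟨ -‿+-comm _ _ ⟨
    - (a * (x * y)) + - (b * (x * z)) ≈⟨ +-cong (-‿distribʳ-* a _) (-‿distribʳ-* b _) ⟩
    a * - (x * y) + b * - (x * z)   ∎
  signed-combination (suc (suc m)) = signed-combination m

  signed-adjacent : ∀ {n} (k : Fin n) x → signed F (toℕ (suc k)) x ≈ - signed F (toℕ (inject₁ k)) x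
  signed-adjacent k x rewrite toℕ-inject₁ k = signed-suc (toℕ k) x

  Minor : ∀ {n} → Matrix F (suc n) → Fin (suc n) → Matrix F n
  Minor M j r s = M (suc r) (punchIn j s)

  laplaceTerm : ∀ {n} → Matrix F (suc n) → Fin (suc n) → Carrier
  laplaceTerm {n} M j = signed F (toℕ j) (M zero j * det F n (Minor M j))

  det-cong : ∀ n {M N : Matrix F n} → (∀ i j → M i j ≈ N i j) → det F n M ≈ det F n N
  det-cong zero    e = refl
  det-cong (suc n) e = sum-cong (suc n) (λ j → signed-cong (toℕ j)
    (*-cong (e zero j) (det-cong n (λ r s → e (suc r) (punchIn j s)))))

  swapColumns : ∀ {n} → Fin n → Matrix F (suc n) → Matrix F (suc n)
  swapColumns k M i j = M i (swap k j)

  laplaceTerm-reindex : ∀ {n} (k : Fin n) (M : Matrix F (suc n)) j {j'} {N : Matrix F n} → swap k j ≡ j' →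
    (∀ r s → M (suc r) (swap k (punchIn j s)) ≈ N r s) →
    laplaceTerm (swapColumns k M) j ≈ signed F (toℕ j) (M zero j' * det F n N)
  laplaceTerm-reindex {n} k M j ≡.refl e = signed-cong (toℕ j) (*-congˡ (det-cong n e))

  -- Swapping two adjacent columns negates the determinant: the swap permutes
  -- the Laplace terms, and each of them changes sign (mutual recursion).
  det-swap : ∀ n (k : Fin n) (M : Matrix F (suc n)) → det F (suc n) (swapColumns k M) ≈ - det F (suc n) M
  laplaceTerm-swap : ∀ n (k : Fin n) (M : Matrix F (suc n)) j →
    laplaceTerm (swapColumns k M) j ≈ - laplaceTerm M (swap k j)

  det-swap (suc n) k M = begin
    Σ[ suc (suc n) ] laplaceTerm (swapColumns k M)       ≈⟨ sum-cong (suc (suc n)) (laplaceTerm-swap (suc n) k M) ⟩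
    Σ[ suc (suc n) ] (λ j → - laplaceTerm M (swap k j))  ≈⟨ sum-neg (suc (suc n)) (λ j → laplaceTerm M (swap k j)) ⟩
    - Σ[ suc (suc n) ] (λ j → laplaceTerm M (swap k j))  ≈⟨ -‿cong (sum-swap (suc n) k (laplaceTerm M)) ⟩
    - Σ[ suc (suc n) ] laplaceTerm M                     ∎

  laplaceTerm-swap (suc n) k M j with j ≟ inject₁ k | j ≟ suc k
  ... | yes ≡.refl | _ = begin
    laplaceTerm (swapColumns k M) (inject₁ k)
      ≈⟨ laplaceTerm-reindex k M (inject₁ k) (swap-left k) (λ r s → reflexive (≡.cong (M (suc r)) (swap-punchIn-left k s))) ⟩
    signed F (toℕ (inject₁ k)) (M zero (suc k) * det F (suc n) (Minor M (suc k)))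
      ≈⟨ sym (-‿involutive _) ⟩
    - - signed F (toℕ (inject₁ k)) (M zero (suc k) * det F (suc n) (Minor M (suc k)))
      ≈⟨ -‿cong (sym (signed-adjacent k _)) ⟩
    - laplaceTerm M (suc k)
      ≡⟨ ≡.cong (λ j → - laplaceTerm M j) (swap-left k) ⟨
    - laplaceTerm M (swap k (inject₁ k)) ∎
  ... | no _ | yes ≡.refl = begin
    laplaceTerm (swapColumns k M) (suc k)
      ≈⟨ laplaceTerm-reindex k M (suc k) (swap-right k) (λ r s → reflexive (≡.cong (M (suc r)) (swap-punchIn-right k s))) ⟩
    signed F (toℕ (suc k)) (M zero (inject₁ k) * det F (suc n) (Minor M (inject₁ k)))
      ≈⟨ signed-adjacent k _ ⟩
    - laplaceTerm M (inject₁ k)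
      ≡⟨ ≡.cong (λ j → - laplaceTerm M j) (swap-right k) ⟨
    - laplaceTerm M (swap k (suc k)) ∎
  ... | no ≢l | no ≢r with swap-punchIn-other k j ≢l ≢r
  ... | k' , commute = begin
    laplaceTerm (swapColumns k M) j
      ≈⟨ laplaceTerm-reindex k M j (swap-other k j ≢l ≢r) (λ r s → reflexive (≡.cong (M (suc r)) (commute s))) ⟩
    signed F (toℕ j) (M zero j * det F (suc n) (swapColumns k' (Minor M j)))
      ≈⟨ signed-cong (toℕ j) (*-congˡ (det-swap n k' (Minor M j))) ⟩
    signed F (toℕ j) (M zero j * - det F (suc n) (Minor M j))
      ≈⟨ signed-cong (toℕ j) (sym (-‿distribʳ-* _ _)) ⟩
    signed F (toℕ j) (- (M zero j * det F (suc n) (Minor M j)))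
      ≈⟨ signed-neg (toℕ j) _ ⟩
    - laplaceTerm M j
      ≡⟨ ≡.cong (λ j → - laplaceTerm M j) (swap-other k j ≢l ≢r) ⟨
    - laplaceTerm M (swap k j) ∎

  withColumn₀ : ∀ {n} → Matrix F (suc n) → (Fin (suc n) → Carrier) → Matrix F (suc n)
  withColumn₀ M u i zero    = u i
  withColumn₀ M u i (suc j) = M i (suc j)

  withColumn₀-cong : ∀ n (M : Matrix F (suc n)) {u u' : Fin (suc n) → Carrier} → (∀ i → u i ≈ u' i) →
    det F (suc n) (withColumn₀ M u) ≈ det F (suc n) (withColumn₀ M u')
  withColumn₀-cong n M {u} {u'} e = det-cong (suc n) {withColumn₀ M u} {withColumn₀ M u'} λ where
    i zero    → e i
    i (suc j) → refl

  minor-withColumn₀ : ∀ n (M : Matrix F (suc (suc n))) w (j : Fin (suc n)) →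
    det F (suc n) (Minor (withColumn₀ M w) (suc j)) ≈ det F (suc n) (withColumn₀ (Minor M (suc j)) (λ r → w (suc r)))
  minor-withColumn₀ n M w j =
    det-cong (suc n) {Minor (withColumn₀ M w) (suc j)} {withColumn₀ (Minor M (suc j)) (λ r → w (suc r))} λ where
    r zero    → refl
    r (suc s) → refl

  det-linear₀ : ∀ n (M : Matrix F (suc n)) (u u' : Fin (suc n) → Carrier) a b →
    det F (suc n) (withColumn₀ M (λ i → a * u i + b * u' i))
      ≈ a * det F (suc n) (withColumn₀ M u) + b * det F (suc n) (withColumn₀ M u')
  det-linear₀ zero M u u' a b =
    trans (entry _) (sym (+-cong (*-congˡ (entry (u zero))) (*-congˡ (entry (u' zero)))))
    where
    -- a 1 × 1 determinant is its entry
    entry : ∀ z → z * 1# + 0# ≈ z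
    entry z = trans (+-identityʳ _) (*-identityʳ z)
  det-linear₀ (suc n) M u u' a b =
    trans (+-congˡ (trans (sum-cong (suc n) term) (sum-combination (suc n) a b (T u) (T u'))))
          (collect a b (u zero) (u' zero) (det F (suc n) (Minor M zero)) _ _)
    where
    T : (Fin (suc (suc n)) → Carrier) → Fin (suc n) → Carrier
    T w j = laplaceTerm (withColumn₀ M w) (suc j)

    tail : (Fin (suc (suc n)) → Carrier) → Fin (suc n) → Carrier
    tail w r = w (suc r)

    term : ∀ j → T (λ i → a * u i + b * u' i) j ≈ a * T u j + b * T u' j
    term j = begin
      T (λ i → a * u i + b * u' i) j
        ≈⟨ signed-cong (toℕ (suc j)) (*-congˡ (minor-withColumn₀ n M _ j)) ⟩
      signed F (toℕ (suc j)) (M zero (suc j) * det F (suc n) (withColumn₀ (Minor M (suc j)) (λ r → a * u (suc r) + b * u' (suc r))))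
        ≈⟨ signed-cong (toℕ (suc j)) (*-congˡ (det-linear₀ n (Minor M (suc j)) (tail u) (tail u') a b)) ⟩
      signed F (toℕ (suc j)) (M zero (suc j) * (a * det F (suc n) (withColumn₀ (Minor M (suc j)) (tail u))
                                               + b * det F (suc n) (withColumn₀ (Minor M (suc j)) (tail u'))))
        ≈⟨ signed-combination (toℕ (suc j)) _ a _ b _ ⟩
      a * signed F (toℕ (suc j)) (M zero (suc j) * det F (suc n) (withColumn₀ (Minor M (suc j)) (tail u)))
        + b * signed F (toℕ (suc j)) (M zero (suc j) * det F (suc n) (withColumn₀ (Minor M (suc j)) (tail u')))
        ≈⟨ +-cong (*-congˡ (signed-cong (toℕ (suc j)) (*-congˡ (sym (minor-withColumn₀ n M u j)))))
                  (*-congˡ (signed-cong (toℕ (suc j)) (*-congˡ (sym (minor-withColumn₀ n M u' j))))) ⟩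
      a * T u j + b * T u' j ∎

  det-linear₀-sum : ∀ n (M : Matrix F (suc n)) m (x : Fin m → Carrier) (U : Fin m → Fin (suc n) → Carrier) →
    det F (suc n) (withColumn₀ M (λ i → Σ[ m ] (λ l → x l * U l i)))
      ≈ Σ[ m ] (λ l → x l * det F (suc n) (withColumn₀ M (U l)))
  det-linear₀-sum n M zero x U = begin
    det F (suc n) (withColumn₀ M (λ i → 0#))
      ≈⟨ withColumn₀-cong n M (λ i → sym (trans (+-cong (zeroˡ 0#) (zeroˡ 0#)) (+-identityʳ 0#))) ⟩
    det F (suc n) (withColumn₀ M (λ i → 0# * 0# + 0# * 0#))
      ≈⟨ det-linear₀ n M (λ i → 0#) (λ i → 0#) 0# 0# ⟩
    0# * _ + 0# * _
      ≈⟨ trans (+-cong (zeroˡ _) (zeroˡ _)) (+-identityʳ 0#) ⟩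
    0# ∎
  det-linear₀-sum n M (suc m) x U = begin
    det F (suc n) (withColumn₀ M (λ i → x zero * U zero i + Σ[ m ] (λ l → x (suc l) * U (suc l) i)))
      ≈⟨ withColumn₀-cong n M (λ i → +-congˡ (sym (*-identityˡ _))) ⟩
    det F (suc n) (withColumn₀ M (λ i → x zero * U zero i + 1# * Σ[ m ] (λ l → x (suc l) * U (suc l) i)))
      ≈⟨ det-linear₀ n M _ _ (x zero) 1# ⟩
    x zero * det F (suc n) (withColumn₀ M (U zero))
      + 1# * det F (suc n) (withColumn₀ M (λ i → Σ[ m ] (λ l → x (suc l) * U (suc l) i)))
      ≈⟨ +-congˡ (trans (*-identityˡ _) (det-linear₀-sum n M m (λ l → x (suc l)) (λ l → U (suc l)))) ⟩
    Σ[ suc m ] (λ l → x l * det F (suc n) (withColumn₀ M (U l))) ∎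

  -- A matrix whose first column equals its column k + 1 has determinant 0.
  -- Adjacent swaps move column k + 1 next to the first one, where the swap
  -- leaves M unchanged, so det M = - det M; the recursion is on toℕ k.
  det-equalColumns : ∀ n (M : Matrix F (suc n)) (k : Fin n) → (∀ i → M i zero ≈ M i (suc k)) → det F (suc n) M ≈ 0#
  det-equalColumns n M k = go (toℕ k) n M k ≡.refl
    where
    go : ∀ d n (M : Matrix F (suc n)) (k : Fin n) → toℕ k ≡ d → (∀ i → M i zero ≈ M i (suc k)) → det F (suc n) M ≈ 0#
    go _ (suc n) M zero _ e = self-negative⇒0 (trans (det-cong (suc (suc n)) swapped) (det-swap (suc n) zero M))
      where
      swapped : ∀ i j → M i j ≈ M i (swap zero j)
      swapped i zero          = e i
      swapped i (suc zero)    = sym (e i)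
      swapped i (suc (suc j)) = refl
    go zero    (suc n) M (suc k) () e
    go (suc d) (suc n) M (suc k) toℕk≡ e = negation≈0 (trans (sym (det-swap (suc n) (suc k) M))
      (go d (suc n) (swapColumns (suc k) M) (inject₁ k)
          (≡.trans (toℕ-inject₁ k) (ℕ.suc-injective toℕk≡))
          (λ i → trans (e i) (reflexive (≡.cong (λ z → M i (suc z)) (≡.sym (swap-left k)))))))

  _·_at_ : ∀ {n} → Matrix F n → (Fin n → Carrier) → Fin n → Carrier
  _·_at_ {n} M v i = Σ[ n ] (λ j → M i j * v j)

  -- If M v = 0 with v 0 ≠ 0, the first column of M is a combination of the
  -- others, so det M = 0 by linearity and det-equalColumns.
  det-kernel₀ : ∀ n (M : Matrix F (suc n)) (v : Fin (suc n) → Carrier) → ¬ v zero ≈ 0# →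
    (∀ i → M · v at i ≈ 0#) → det F (suc n) M ≈ 0#
  det-kernel₀ n M v v₀≉0 Mv≈0 with inverse (v zero) v₀≉0
  ... | w , v₀w≈1 = begin
    det F (suc n) M
      ≈⟨ det-cong (suc n) column₀-combination ⟩
    det F (suc n) (withColumn₀ M (λ i → Σ[ n ] (λ l → x l * M i (suc l))))
      ≈⟨ det-linear₀-sum n M n x (λ l i → M i (suc l)) ⟩
    Σ[ n ] (λ l → x l * det F (suc n) (withColumn₀ M (λ i → M i (suc l))))
      ≈⟨ sum-zero n (λ l → trans (*-congˡ (det-equalColumns n (withColumn₀ M (λ i → M i (suc l))) l (λ i → refl))) (zeroʳ _)) ⟩
    0# ∎
    where
    x : Fin n → Carrier
    x l = - w * v (suc l)

    rest : Fin (suc n) → Carrier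
    rest i = Σ[ n ] (λ l → M i (suc l) * v (suc l))

    column₀ : ∀ i → Σ[ n ] (λ l → x l * M i (suc l)) ≈ M i zero
    column₀ i = begin
      Σ[ n ] (λ l → x l * M i (suc l))
        ≈⟨ sum-cong n (λ l → trans (*-assoc (- w) _ _) (*-congˡ (*-comm _ _))) ⟩
      Σ[ n ] (λ l → - w * (M i (suc l) * v (suc l)))
        ≈⟨ sum-*ˡ n (- w) _ ⟩
      - w * rest i
        ≈⟨ *-congˡ (+-inverseʳ-unique _ _ (Mv≈0 i)) ⟩
      - w * - (M i zero * v zero)
        ≈⟨ -‿distribʳ-* (- w) _ ⟨
      - (- w * (M i zero * v zero))
        ≈⟨ -‿cong (-‿distribˡ-* w _) ⟨
      - - (w * (M i zero * v zero))
        ≈⟨ -‿involutive _ ⟩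
      w * (M i zero * v zero)
        ≈⟨ trans (*-comm w _) (*-assoc _ _ w) ⟩
      M i zero * (v zero * w)
        ≈⟨ *-congˡ v₀w≈1 ⟩
      M i zero * 1#
        ≈⟨ *-identityʳ _ ⟩
      M i zero ∎

    column₀-combination : ∀ i j → M i j ≈ withColumn₀ M (λ i → Σ[ n ] (λ l → x l * M i (suc l))) i j
    column₀-combination i zero    = sym (column₀ i)
    column₀-combination i (suc j) = refl

  -- A square matrix with a nonzero kernel vector has determinant 0.  The
  -- nonzero coordinate is moved to the front by adjacent column swaps
  -- (recursion on its position).
  det-kernel : ∀ n (M : Matrix F n) (v : Fin n → Carrier) (p : Fin n) → ¬ v p ≈ 0# →
    (∀ i → M · v at i ≈ 0#) → det F n M ≈ 0#
  det-kernel (suc n) M v p = go (toℕ p) M v p ≡.refl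
    where
    go : ∀ d (M : Matrix F (suc n)) (v : Fin (suc n) → Carrier) (p : Fin (suc n)) → toℕ p ≡ d →
      ¬ v p ≈ 0# → (∀ i → M · v at i ≈ 0#) → det F (suc n) M ≈ 0#
    go _       M v zero    _ vp≉0 Mv≈0 = det-kernel₀ n M v vp≉0 Mv≈0
    go zero    M v (suc k) () vp≉0 Mv≈0
    go (suc d) M v (suc k) toℕp≡ vp≉0 Mv≈0 = negation≈0 (trans (sym (det-swap n k M))
      (go d (swapColumns k M) (λ j → v (swap k j)) (inject₁ k)
          (≡.trans (toℕ-inject₁ k) (ℕ.suc-injective toℕp≡))
          (λ e → vp≉0 (trans (reflexive (≡.cong v (≡.sym (swap-left k)))) e))
          (λ i → trans (sum-swap n k (λ j → M i j * v j)) (Mv≈0 i))))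

  listSum : ∀ {X : Set} → (X → Carrier) → List X → Carrier
  listSum f []       = 0#
  listSum f (x ∷ xs) = f x + listSum f xs

  sum-lookup : ∀ {X : Set} (f : X → Carrier) (xs : List X) →
    Σ[ length xs ] (λ q → f (lookup xs q)) ≈ listSum f xs
  sum-lookup f []       = refl
  sum-lookup f (x ∷ xs) = +-congˡ (sum-lookup f xs)

  listSum-cong : ∀ {X : Set} {f g : X → Carrier} (xs : List X) → (∀ x → f x ≈ g x) → listSum f xs ≈ listSum g xs
  listSum-cong []       e = refl
  listSum-cong (x ∷ xs) e = +-cong (e x) (listSum-cong xs e)

  listSum-zero : ∀ {X : Set} {f : X → Carrier} (xs : List X) → (∀ x → f x ≈ 0#) → listSum f xs ≈ 0#
  listSum-zero []       e = refl
  listSum-zero (x ∷ xs) e = trans (+-cong (e x) (listSum-zero xs e)) (+-identityʳ 0#)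

  listSum-++ : ∀ {X : Set} (f : X → Carrier) (xs ys : List X) → listSum f (xs ++ ys) ≈ listSum f xs + listSum f ys
  listSum-++ f []       ys = sym (+-identityˡ _)
  listSum-++ f (x ∷ xs) ys = trans (+-congˡ (listSum-++ f xs ys)) (sym (+-assoc _ _ _))

  listSum-map : ∀ {X Y : Set} (f : Y → Carrier) (g : X → Y) (xs : List X) →
    listSum f (map g xs) ≈ listSum (λ x → f (g x)) xs
  listSum-map f g []       = refl
  listSum-map f g (x ∷ xs) = +-congˡ (listSum-map f g xs)

  -- The enumeration of Fin n used inside the definition of pairs.
  enumFin : ∀ n → List (Fin n)
  enumFin zero    = []
  enumFin (suc n) = zero ∷ map suc (enumFin n)

  listSum-enumFin : ∀ n (f : Fin n → Carrier) → listSum f (enumFin n) ≈ Σ[ n ] f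
  listSum-enumFin zero    f = refl
  listSum-enumFin (suc n) f = +-congˡ (trans (listSum-map f suc (enumFin n)) (listSum-enumFin n (λ i → f (suc i))))

  ∈-enumFin : ∀ n (j : Fin n) → j ∈ enumFin n
  ∈-enumFin (suc n) zero    = here ≡.refl
  ∈-enumFin (suc n) (suc j) = there (∈-map⁺ suc (∈-enumFin n j))

  firstRowPair : ∀ {n} → Fin n → Fin (suc n) × Fin (suc n)
  firstRowPair j = (zero , suc j)

  shiftPair : ∀ {n} → Fin n × Fin n → Fin (suc n) × Fin (suc n)
  shiftPair (l , m) = (suc l , suc m)

  -- The definition of pairs uses a local enumeration of Fin n, which
  -- is named through the witness of this decomposition and shown to be enumFin.
  pairs-shape : ∀ n → ∃[ js ] (pairs F (suc n) ≡ map firstRowPair js ++ map shiftPair (pairs F n))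
  pairs-shape n = _ , ≡.refl

  pairs-shape-enumFin : ∀ n → proj₁ (pairs-shape n) ≡ enumFin n
  pairs-shape-enumFin zero    = ≡.refl
  pairs-shape-enumFin (suc n) = ≡.cong (λ js → zero ∷ map suc js) (pairs-shape-enumFin n)

  pairs-suc : ∀ n → pairs F (suc n) ≡ map firstRowPair (enumFin n) ++ map shiftPair (pairs F n)
  pairs-suc n = ≡.trans (proj₂ (pairs-shape n))
    (≡.cong (λ js → map firstRowPair js ++ map shiftPair (pairs F n)) (pairs-shape-enumFin n))

  ∈-pairs : ∀ n (a b : Fin n) → toℕ a < toℕ b → (a , b) ∈ pairs F n
  ∈-pairs (suc n) zero    zero    ()
  ∈-pairs (suc n) zero    (suc b) _ =
    ≡.subst ((zero , suc b) ∈_) (≡.sym (pairs-suc n)) (∈-++⁺ˡ (∈-map⁺ firstRowPair (∈-enumFin n b)))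
  ∈-pairs (suc n) (suc a) zero    ()
  ∈-pairs (suc n) (suc a) (suc b) (s≤s a<b) =
    ≡.subst ((suc a , suc b) ∈_) (≡.sym (pairs-suc n))
      (∈-++⁺ʳ (map firstRowPair (enumFin n)) (∈-map⁺ shiftPair (∈-pairs n a b a<b)))

  symmetrised : ∀ {n} → (Fin n → Fin n → Carrier) → Fin n × Fin n → Carrier
  symmetrised B (l , m) = B l m + B m l

  pairSum : ∀ n (B : Fin n → Fin n → Carrier) →
    listSum (symmetrised B) (pairs F n) + Σ[ n ] (λ l → B l l) ≈ Σ[ n ] (λ l → Σ[ n ] (B l))
  pairSum zero    B = +-identityʳ 0#
  pairSum (suc n) B = begin
    listSum (symmetrised B) (pairs F (suc n)) + (B zero zero + diagonal)
      ≡⟨ ≡.cong (λ ps → listSum (symmetrised B) ps + (B zero zero + diagonal)) (pairs-suc n) ⟩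
    listSum (symmetrised B) (map firstRowPair (enumFin n) ++ map shiftPair (pairs F n)) + (B zero zero + diagonal)
      ≈⟨ +-congʳ (trans (listSum-++ (symmetrised B) (map firstRowPair (enumFin n)) (map shiftPair (pairs F n)))
                  (+-cong (trans (listSum-map (symmetrised B) firstRowPair (enumFin n)) (listSum-enumFin n _))
                          (listSum-map (symmetrised B) shiftPair (pairs F n)))) ⟩
    (Σ[ n ] (λ j → B zero (suc j) + B (suc j) zero) + rest) + (B zero zero + diagonal)
      ≈⟨ +-congʳ (+-congʳ (sum-+ n _ _)) ⟩
    ((row + column) + rest) + (B zero zero + diagonal)
      ≈⟨ regroup row column rest (B zero zero) diagonal ⟩
    (B zero zero + row) + (column + (rest + diagonal))
      ≈⟨ +-congˡ (+-congˡ (pairSum n B')) ⟩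
    (B zero zero + row) + (column + Σ[ n ] (λ l → Σ[ n ] (B' l)))
      ≈⟨ +-congˡ (sum-+ n _ _) ⟨
    Σ[ suc n ] (λ l → Σ[ suc n ] (B l)) ∎
    where
    B' : Fin n → Fin n → Carrier
    B' l m = B (suc l) (suc m)
    row column rest diagonal : Carrier
    row      = Σ[ n ] (λ j → B zero (suc j))
    column   = Σ[ n ] (λ j → B (suc j) zero)
    rest     = listSum (symmetrised B') (pairs F n)
    diagonal = Σ[ n ] (λ l → B' l l)
    regroup : ∀ r c s b d → ((r + c) + s) + (b + d) ≈ (b + r) + (c + (s + d))
    regroup = solve 5 (λ r c s b d → (((r ⊕ c) ⊕ s) ⊕ (b ⊕ d)) ⊜ ((b ⊕ r) ⊕ (c ⊕ (s ⊕ d)))) refl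

  fixed⇒kernel : ∀ {N} (M : Matrix F N) (v : Fin N → Carrier) → (∀ p → M · v at p ≈ v p) →
    ∀ p → (_-ᴹ_ F (identity F) M) · v at p ≈ 0#
  fixed⇒kernel {N} M v Mv≈v p = begin
    Σ[ N ] (λ q → (identity F p q + - M p q) * v q)
      ≈⟨ sum-cong N (λ q → trans (distribʳ (v q) _ _) (+-congˡ (sym (-‿distribˡ-* _ _)))) ⟩
    Σ[ N ] (λ q → identity F p q * v q + - (M p q * v q))
      ≈⟨ sum-+ N _ _ ⟩
    Σ[ N ] (λ q → identity F p q * v q) + Σ[ N ] (λ q → - (M p q * v q))
      ≈⟨ +-cong (sum-identity N p v) (trans (sum-neg N _) (-‿cong (Mv≈v p))) ⟩
    v p + - v p
      ≈⟨ -‿inverseʳ _ ⟩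
    0# ∎

  module _ {n t : ℕ} (cl : Fin n → Fin t) where

    classGap : Fin n → Fin n → Carrier
    classGap l m with cl l ≟ cl m
    ... | yes _ = 0#
    ... | no  _ = 1#

    classGap-same : ∀ {l m} → cl l ≡ cl m → classGap l m ≈ 0#
    classGap-same {l} {m} e with cl l ≟ cl m
    ... | yes _     = refl
    ... | no apart  = ⊥-elim (apart e)

    classGap-different : ∀ {l m} → cl l ≢ cl m → classGap l m ≈ 1#
    classGap-different {l} {m} apart with cl l ≟ cl m
    ... | yes e = ⊥-elim (apart e)
    ... | no _  = refl

    classGap-sym : ∀ l m → classGap l m ≈ classGap m l
    classGap-sym l m with cl l ≟ cl m
    ... | yes e     = sym (classGap-same (≡.sym e))
    ... | no apart  = sym (classGap-different (λ e → apart (≡.sym e)))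

    gapVector : Fin (C2 F n) → Carrier
    gapVector q = classGap (proj₁ (pair F q)) (proj₂ (pair F q))

    gapVector-at : ∀ {x y} → cl x ≢ cl y → toℕ x < toℕ y → ∃[ q ] ¬ gapVector q ≈ 0#
    gapVector-at {x} {y} apart x<y = index listed , λ gap≈0 → nontrivial (sym (begin
      1#                        ≈⟨ classGap-different apart ⟨
      classGap x y              ≡⟨ ≡.cong (λ lm → classGap (proj₁ lm) (proj₂ lm)) (lookup-index listed) ⟩
      gapVector (index listed)  ≈⟨ gap≈0 ⟩
      0#                        ∎))
      where
      listed : (x , y) ∈ pairs F n
      listed = ∈-pairs n x y x<y

    gapVector-nonzero : ∀ {a b} → cl a ≢ cl b → ∃[ q ] ¬ gapVector q ≈ 0#
    gapVector-nonzero {a} {b} apart with <-cmp a b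
    ... | tri< a<b _ _ = gapVector-at apart a<b
    ... | tri≈ _ a≡b _ = ⊥-elim (apart (≡.cong cl a≡b))
    ... | tri> _ _ b<a = gapVector-at (λ e → apart (≡.sym e)) b<a

  annihilated : ∀ {p z w} → p ≈ 0# → p * z ≈ p * w
  annihilated p≈0 = trans (*-congʳ p≈0) (trans (zeroˡ _) (sym (trans (*-congʳ p≈0) (zeroˡ _))))

  whenPositive : ∀ {x y z w} → NonNeg F x → NonNeg F y → (Pos x → Pos y → z ≈ w) → (x * y) * z ≈ (x * y) * w
  whenPositive (inj₁ x>0) (inj₁ y>0) z≈w = *-congˡ (z≈w x>0 y>0)
  whenPositive (inj₂ x≈0) _          _   = annihilated (trans (*-congʳ x≈0) (zeroˡ _))
  whenPositive (inj₁ _)   (inj₂ y≈0) _   = annihilated (trans (*-congˡ y≈0) (zeroʳ _))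

  module _ {n t : ℕ} (cl : Fin n → Fin t) (A : Matrix F n)
           (nonneg : ∀ i j → NonNeg F (A i j)) (rowSum : ∀ i → Σ[ n ] (A i) ≈ 1#)
           (forward : ∀ {i j l m} → Edge F A i l → Edge F A j m → cl i ≡ cl j → cl l ≡ cl m)
           (backward : ∀ {i j l m} → Edge F A i l → Edge F A j m → cl l ≡ cl m → cl i ≡ cl j) where

    sameClass-term : ∀ {i j} → cl i ≡ cl j → ∀ l m → (A i l * A j m) * classGap cl l m ≈ 0#
    sameClass-term same l m =
      trans (whenPositive (nonneg _ l) (nonneg _ m) (λ il jm → classGap-same cl (forward il jm same))) (zeroʳ _)

    differentClass-term : ∀ {i j} → cl i ≢ cl j → ∀ l m → (A i l * A j m) * classGap cl l m ≈ A i l * A j m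
    differentClass-term apart l m =
      trans (whenPositive (nonneg _ l) (nonneg _ m) (λ il jm → classGap-different cl (λ e → apart (backward il jm e))))
            (*-identityʳ _)

    -- Indices of different classes have no common successor.
    differentClass-diagonal : ∀ {i j} → cl i ≢ cl j → ∀ l → A i l * A j l ≈ 0#
    differentClass-diagonal apart l = begin
      A _ l * A _ l          ≈⟨ *-identityʳ _ ⟨
      (A _ l * A _ l) * 1#   ≈⟨ whenPositive (nonneg _ l) (nonneg _ l) (λ il jl → ⊥-elim (apart (backward il jl ≡.refl))) ⟩
      (A _ l * A _ l) * 0#   ≈⟨ zeroʳ _ ⟩
      0#                     ∎

    compound2-fixes-gapVector : ∀ p → compound2 F A · gapVector cl at p ≈ gapVector cl p
    compound2-fixes-gapVector p = trans (sum-lookup term (pairs F n)) (byClasses (cl i ≟ cl j))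
      where
      i j : Fin n
      i = proj₁ (pair F p)
      j = proj₂ (pair F p)

      B : Fin n → Fin n → Carrier
      B l m = A i l * A j m

      term : Fin n × Fin n → Carrier
      term (l , m) = (B l m + B m l) * classGap cl l m

      byClasses : Dec (cl i ≡ cl j) → listSum term (pairs F n) ≈ classGap cl i j
      byClasses (yes same) = begin
        listSum term (pairs F n)
          ≈⟨ listSum-zero (pairs F n) (λ (l , m) → trans (distribʳ _ _ _)
               (trans (+-cong (sameClass-term same l m) (trans (*-congˡ (classGap-sym cl l m)) (sameClass-term same m l)))
                      (+-identityʳ 0#))) ⟩
        0#
          ≈⟨ classGap-same cl same ⟨
        classGap cl i j ∎
      byClasses (no apart) = begin
        listSum term (pairs F n)
          ≈⟨ listSum-cong (pairs F n) (λ (l , m) → trans (distribʳ _ _ _)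
               (+-cong (differentClass-term apart l m)
                       (trans (*-congˡ (classGap-sym cl l m)) (differentClass-term apart m l)))) ⟩
        listSum (symmetrised B) (pairs F n)
          ≈⟨ +-identityʳ _ ⟨
        listSum (symmetrised B) (pairs F n) + 0#
          ≈⟨ +-congˡ (sum-zero n (differentClass-diagonal apart)) ⟨
        listSum (symmetrised B) (pairs F n) + Σ[ n ] (λ l → B l l)
          ≈⟨ pairSum n B ⟩
        Σ[ n ] (λ l → Σ[ n ] (B l))
          ≈⟨ sum-cong n (λ l → trans (sum-*ˡ n (A i l) (A j)) (trans (*-congˡ (rowSum j)) (*-identityʳ _))) ⟩
        Σ[ n ] (A i)
          ≈⟨ rowSum i ⟩
        1#
          ≈⟨ classGap-different cl apart ⟨
        classGap cl i j ∎

-- The successor relation of the cyclic order on Fin t, as in Periodic.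
CyclicSuccessor : ∀ t → Fin t → Fin t → Set
CyclicSuccessor t k l = (suc (toℕ k) ≡ toℕ l) ⊎ (suc (toℕ k) ≡ t × toℕ l ≡ 0)

successor-functional : ∀ {t} {a b b' : Fin t} → CyclicSuccessor t a b → CyclicSuccessor t a b' → b ≡ b'
successor-functional (inj₁ ab)     (inj₁ ab')      = toℕ-injective (≡.trans (≡.sym ab) ab')
successor-functional {b = b} (inj₁ ab) (inj₂ (last , _)) = ⊥-elim (ℕ.<-irrefl (≡.trans (≡.sym ab) last) (toℕ<n b))
successor-functional {b' = b'} (inj₂ (last , _)) (inj₁ ab') = ⊥-elim (ℕ.<-irrefl (≡.trans (≡.sym ab') last) (toℕ<n b'))
successor-functional (inj₂ (_ , b≡0)) (inj₂ (_ , b'≡0)) = toℕ-injective (≡.trans b≡0 (≡.sym b'≡0))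

successor-injective : ∀ {t} {a a' b : Fin t} → CyclicSuccessor t a b → CyclicSuccessor t a' b → a ≡ a'
successor-injective (inj₁ ab)       (inj₁ a'b)       = toℕ-injective (ℕ.suc-injective (≡.trans ab (≡.sym a'b)))
successor-injective (inj₁ ab)       (inj₂ (_ , b≡0)) = ⊥-elim (ℕ.1+n≢0 (≡.trans ab b≡0))
successor-injective (inj₂ (_ , b≡0)) (inj₁ a'b)      = ⊥-elim (ℕ.1+n≢0 (≡.trans a'b b≡0))
successor-injective (inj₂ (last , _)) (inj₂ (last' , _)) = toℕ-injective (ℕ.suc-injective (≡.trans last (≡.sym last')))

module _ {r : Level} {n t : ℕ} {R : Fin n → Fin n → Set r} (cl : Fin n → Fin t)
         (edges : ∀ i j → R i j → CyclicSuccessor t (cl i) (cl j)) where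

  classes-forward : ∀ {i j l m} → R i l → R j m → cl i ≡ cl j → cl l ≡ cl m
  classes-forward {i} {j} {l} {m} il jm same =
    successor-functional (edges i l il) (≡.subst (λ k → CyclicSuccessor t k (cl m)) (≡.sym same) (edges j m jm))

  classes-backward : ∀ {i j l m} → R i l → R j m → cl l ≡ cl m → cl i ≡ cl j
  classes-backward {i} {j} {l} {m} il jm same =
    successor-injective (edges i l il) (≡.subst (CyclicSuccessor t (cl j)) (≡.sym same) (edges j m jm))

separated : ∀ {n t} (cl : Fin n → Fin t) → 2 ≤ t → Surjective _≡_ _≡_ cl → ∃[ a ] ∃[ b ] (cl a ≢ cl b)
separated {t = suc zero} cl (s≤s ()) onto
separated {t = suc (suc t)} cl _ onto with onto zero | onto (suc zero)
... | a , cla≡0 | b , clb≡1 = a , b , λ e → 0≢1 (≡.trans (≡.sym (cla≡0 ≡.refl)) (≡.trans e (clb≡1 ≡.refl)))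
  where
  0≢1 : zero ≢ suc {suc t} zero
  0≢1 ()

mainTheorem11 : ∀ {c ℓ : Level} (F : OrderedField c ℓ) (n : ℕ) (A : Matrix F n) →
    Stochastic F A → Irreducible F A → Periodic F A →
    OrderedField._≈_ F (det F (C2 F n) (_-ᴹ_ F (identity F) (compound2 F A))) (OrderedField.0# F)
mainTheorem11 F n A (nonneg , rowSum) _ (t , 2≤t , cl , onto , edges)
  with gapVector-nonzero F cl (proj₂ (proj₂ (separated cl 2≤t onto)))
... | q , gap≉0 =
  det-kernel F (C2 F n) (_-ᴹ_ F (identity F) (compound2 F A)) (gapVector F cl) q gap≉0
    (fixed⇒kernel F (compound2 F A) (gapVector F cl)
      (compound2-fixes-gapVector F cl A nonneg rowSum (classes-forward cl edges) (classes-backward cl edges)))
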